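{- Let $r\geq 2$ and $t\geq 2$ be integers and let $n\geq (t+1)r-\lceil t/2\rceil$. If $S$ is a set of $t$ vertices of $K(n,r)$, then there exists a vertex $w$ of $K(n,r)$ such that $S\subseteq N[w]$.
   Context: The Kneser graph $K(n,r)$ has as vertices the $r$-subsets of $[n]=\{1,\dots,n\}$, two vertices adjacent iff disjoint. For a vertex $w$, $N[w]$ is its closed neighbourhood ($w$ together with all vertices disjoint from it). -}

module Defs where

open import Data.Nat.Base using (ℕ)
open import Data.Fin.Subset using (Subset; ∣_∣; _∩_; Empty)
open import Data.Sum.Base using (_⊎_)
open import Relation.Binary.PropositionalEquality using (_≡_)

IsVertex : (n r : ℕ) → Subset n → Set
IsVertex n r v = ∣ v ∣ ≡ r

Adjacent : {n : ℕ} → Subset n → Subset n → Set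
Adjacent u v = Empty (u ∩ v)

InClosedNbhd : {n : ℕ} → Subset n → Subset n → Set
InClosedNbhd w v = (v ≡ w) ⊎ Adjacent w v

{-# OPTIONS --safe #-}
module Submission where

open import Defs
open import Data.Nat.Base using (ℕ; _+_; _*_; _∸_; _≥_; ⌈_/2⌉)
open import Data.Fin.Subset using (Subset)
open import Data.List.Base using (List; length)
open import Data.List.Relation.Unary.All using (All)
open import Data.List.Relation.Unary.Unique.Propositional using (Unique)
open import Data.Product.Base using (Σ; _×_)
open import Relation.Binary.PropositionalEquality using (_≡_)

open import Data.Bool.Base using (if_then_else_)
open import Data.Bool.ListAction using (or)
open import Data.Bool.Properties using (_≟_; T-≡)
open import Data.Fin.Base using (Fin; zero; suc)
open import Data.Fin.Subset
  using (Side; inside; outside; _∈_; _⊆_; _∩_; _∪_; ⋃; ⊥; ∁; ∣_∣; Nonempty)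
open import Data.Fin.Subset.Properties
  using ( x∈p∩q⁺; x∈p∩q⁻; p⊆p∪q; q⊆p∪q; out⊆; in⊆in; ⊥⊆; ∣⊥∣≡0; ∣p∣≤n; ∣p∣≤∣x∷p∣
        ; ∣∁p∣≡n∸∣p∣; x∈∁p⇒x∉p; nonempty?)
open import Data.List.Base using ([]; _∷_; map)
open import Data.List.Membership.Propositional using (find; lose) renaming (_∈_ to _∈ˡ_)
open import Data.List.Properties using (map-cong; map-∘)
import Data.List.Relation.Unary.All as All
open import Data.List.Relation.Unary.All.Properties.Core using (¬All⇒Any¬)
open import Data.List.Relation.Unary.Any as Any using (any?)
open import Data.Nat.Base using (zero; suc; _≤_; _<_; z≤n; s≤s; s≤s⁻¹; _≤ᵇ_)
open import Data.Nat.ListAction using (sum)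
open import Data.Nat.Properties
  using ( ≤-refl; ≤-reflexive; ≤-trans; module ≤-Reasoning; n≤1+n; n≤0⇒n≡0; ≤⇒≤ᵇ
        ; +-comm; +-assoc; +-suc; +-identityʳ; +-commutativeSemigroup
        ; +-mono-≤; +-monoˡ-≤; +-monoʳ-≤; m+n≤o⇒m≤o∸n; *-suc; *-distribˡ-+; *-cancelˡ-<
        ; ⌊n/2⌋≤⌈n/2⌉; ⌊n/2⌋+⌈n/2⌉≡n )
open import Algebra.Properties.CommutativeSemigroup +-commutativeSemigroup using (x∙yz≈y∙xz)
open import Data.Nat.Tactic.RingSolver using (solve-∀)
open import Data.Product.Base using (_,_; ∃; proj₂)
open import Data.Sum.Base using (_⊎_; inj₁; inj₂)
open import Data.Vec.Base using ([]; _∷_; head; tail; lookup; tabulate; here; there)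
open import Data.Vec.Properties
  using (≡-dec; []=⇒lookup; lookup⇒[]=; lookup∘tabulate; tabulate-cong)
open import Function.Base using (_∘_; id)
open import Function.Bundles using (Equivalence)
open import Relation.Binary.PropositionalEquality
  using (refl; sym; trans; cong; cong₂; subst; subst₂; _≢_)
open import Relation.Nullary using (¬_; Dec; yes; no; ¬?; contradiction)
open import Relation.Nullary.Decidable using (_⊎-dec_; decidable-stable)

-- If some member A of S is disjoint from every other member, w = A works. Otherwise every
-- member contains a point lying in at least two members. Counting these incidences point by
-- point, a point of multiplicity c ≥ 2 is counted c ≤ 2 (c − 1) times, so
-- t ≤ 2 (Σ ∣A∣ − ∣⋃ S∣) = 2 (t r − ∣⋃ S∣), i.e. ∣⋃ S∣ ≤ t r − ⌈t/2⌉. The bound on n then leaves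
-- r points outside ⋃ S, and any r of them form a vertex disjoint from all of S.

private
  variable
    n : ℕ

+-exchangeˡ : ∀ a y {x z} → x ≡ y + z → a + x ≡ y + (a + z)
+-exchangeˡ a y {z = z} x≡y+z = trans (cong (a +_) x≡y+z) (x∙yz≈y∙xz a y z)

+-2*-interchange : ∀ a b c d → (a + b) + 2 * (c + d) ≡ (a + 2 * c) + (b + 2 * d)
+-2*-interchange = solve-∀

2*m≤1+2*n⇒m≤n : ∀ m n → 2 * m ≤ suc (2 * n) → m ≤ n
2*m≤1+2*n⇒m≤n m n le =
  s≤s⁻¹ (*-cancelˡ-< 2 m (suc n) (subst (suc (2 * m) ≤_) (sym (*-suc 2 n)) (s≤s le)))

length≤sum-map : ∀ {X : Set} {f : X → ℕ} {xs} →
                 All (λ x → 1 ≤ f x) xs → length xs ≤ sum (map f xs)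
length≤sum-map All.[]         = z≤n
length≤sum-map (1≤fx All.∷ h) = +-mono-≤ 1≤fx (length≤sum-map h)

sum-map-constant : ∀ {X : Set} {f : X → ℕ} {k xs} →
                   All (λ x → f x ≡ k) xs → sum (map f xs) ≡ length xs * k
sum-map-constant All.[]         = refl
sum-map-constant (fx≡k All.∷ h) = cong₂ _+_ fx≡k (sum-map-constant h)

heads : List (Subset (suc n)) → List Side
heads = map head

tails : List (Subset (suc n)) → List (Subset n)
tails = map tail

insideCount : List Side → ℕ
insideCount []              = 0
insideCount (inside  ∷ col) = suc (insideCount col)
insideCount (outside ∷ col) = insideCount col

insideCount-≤-∷ : ∀ s col → insideCount col ≤ insideCount (s ∷ col)
insideCount-≤-∷ inside  col = n≤1+n _
insideCount-≤-∷ outside col = ≤-refl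

module _ {X : Set} (f : X → Side) where

  1≤insideCount-map : ∀ {x xs} → x ∈ˡ xs → f x ≡ inside → 1 ≤ insideCount (map f xs)
  1≤insideCount-map (Any.here refl) fx rewrite fx = s≤s z≤n
  1≤insideCount-map {xs = y ∷ _} (Any.there x∈xs) fx =
    ≤-trans (1≤insideCount-map x∈xs fx) (insideCount-≤-∷ (f y) _)

  2≤insideCount-map : ∀ {x y xs} → x ∈ˡ xs → y ∈ˡ xs → x ≢ y →
                      f x ≡ inside → f y ≡ inside → 2 ≤ insideCount (map f xs)
  2≤insideCount-map (Any.here refl) (Any.here refl) x≢y _ _ = contradiction refl x≢y
  2≤insideCount-map (Any.here refl) (Any.there y∈xs) _ fx fy rewrite fx =
    s≤s (1≤insideCount-map y∈xs fy)
  2≤insideCount-map (Any.there x∈xs) (Any.here refl) _ fx fy rewrite fy =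
    s≤s (1≤insideCount-map x∈xs fx)
  2≤insideCount-map {xs = z ∷ _} (Any.there x∈xs) (Any.there y∈xs) x≢y fx fy =
    ≤-trans (2≤insideCount-map x∈xs y∈xs x≢y fx fy) (insideCount-≤-∷ (f z) _)

column-bound : (col : List Side) →
               (if 2 ≤ᵇ insideCount col then insideCount col else 0) + 2 * (if or col then 1 else 0)
                 ≤ 2 * insideCount col
column-bound []              = z≤n
column-bound (outside ∷ col) = column-bound col
column-bound (inside  ∷ col) = bound (insideCount col)
  where
  bound : ∀ c → (if 2 ≤ᵇ suc c then suc c else 0) + 2 ≤ 2 * suc c
  bound zero    = ≤-refl
  bound (suc c) = +-monoʳ-≤ (2 + c) (s≤s (s≤s z≤n))

∣∷∣ : ∀ s (p : Subset n) → ∣ s ∷ p ∣ ≡ (if s then 1 else 0) + ∣ p ∣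
∣∷∣ inside  p = refl
∣∷∣ outside p = refl

x∈p⇒0<∣p∣ : ∀ {x} {p : Subset n} → x ∈ p → 0 < ∣ p ∣
x∈p⇒0<∣p∣ here                    = s≤s z≤n
x∈p⇒0<∣p∣ {p = s ∷ p} (there x∈p) = ≤-trans (x∈p⇒0<∣p∣ x∈p) (∣p∣≤∣x∷p∣ s p)

⊆-of-size : (p : Subset n) {k : ℕ} → k ≤ ∣ p ∣ → Σ (Subset n) λ q → q ⊆ p × ∣ q ∣ ≡ k
⊆-of-size []            z≤n = [] , id , refl
⊆-of-size (outside ∷ p) k≤∣p∣ =
  let q , q⊆p , ∣q∣≡k = ⊆-of-size p k≤∣p∣ in outside ∷ q , out⊆ q⊆p , ∣q∣≡k
⊆-of-size {suc n} (inside ∷ p) {zero} _ = ⊥ , ⊥⊆ , ∣⊥∣≡0 (suc n)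
⊆-of-size (inside ∷ p) {suc k} (s≤s k≤∣p∣) =
  let q , q⊆p , ∣q∣≡k = ⊆-of-size p k≤∣p∣ in inside ∷ q , in⊆in q⊆p , cong suc ∣q∣≡k

⋃-∷ : (S : List (Subset (suc n))) → ⋃ S ≡ or (heads S) ∷ ⋃ (tails S)
⋃-∷ []      = refl
⋃-∷ (A ∷ S) with s ∷ A′ ← A = cong ((s ∷ A′) ∪_) (⋃-∷ S)

⊆⋃ : ∀ {A} {S : List (Subset n)} → A ∈ˡ S → A ⊆ ⋃ S
⊆⋃ {S = B ∷ S} (Any.here refl)  = p⊆p∪q (⋃ S)
⊆⋃ {S = B ∷ S} (Any.there A∈S) = q⊆p∪q B (⋃ S) ∘ ⊆⋃ A∈S

∣⋃∣-∷ : (S : List (Subset (suc n))) →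
        ∣ ⋃ S ∣ ≡ (if or (heads S) then 1 else 0) + ∣ ⋃ (tails S) ∣
∣⋃∣-∷ S = trans (cong ∣_∣ (⋃-∷ S)) (∣∷∣ (or (heads S)) (⋃ (tails S)))

sum-∣∣-∷ : (S : List (Subset (suc n))) →
           sum (map ∣_∣ S) ≡ insideCount (heads S) + sum (map ∣_∣ (tails S))
sum-∣∣-∷ []                  = refl
sum-∣∣-∷ ((outside ∷ A) ∷ S) = +-exchangeˡ ∣ A ∣ (insideCount (heads S)) (sum-∣∣-∷ S)
sum-∣∣-∷ ((inside  ∷ A) ∷ S) = cong suc (+-exchangeˡ ∣ A ∣ (insideCount (heads S)) (sum-∣∣-∷ S))

sum-∣∩∣-∷ : ∀ s (D : Subset n) (S : List (Subset (suc n))) →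
            sum (map (λ A → ∣ A ∩ (s ∷ D) ∣) S)
              ≡ (if s then insideCount (heads S) else 0) + sum (map (λ A → ∣ A ∩ D ∣) (tails S))
sum-∣∩∣-∷ inside  D []                  = refl
sum-∣∩∣-∷ outside D []                  = refl
sum-∣∩∣-∷ inside  D ((outside ∷ A) ∷ S) =
  +-exchangeˡ ∣ A ∩ D ∣ (insideCount (heads S)) (sum-∣∩∣-∷ inside D S)
sum-∣∩∣-∷ inside  D ((inside  ∷ A) ∷ S) =
  cong suc (+-exchangeˡ ∣ A ∩ D ∣ (insideCount (heads S)) (sum-∣∩∣-∷ inside D S))
sum-∣∩∣-∷ outside D ((outside ∷ A) ∷ S) = cong (∣ A ∩ D ∣ +_) (sum-∣∩∣-∷ outside D S)
sum-∣∩∣-∷ outside D ((inside  ∷ A) ∷ S) = cong (∣ A ∩ D ∣ +_) (sum-∣∩∣-∷ outside D S)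

multiplicity : List (Subset n) → Fin n → ℕ
multiplicity S x = insideCount (map (λ A → lookup A x) S)

multiplicity-zero : (S : List (Subset (suc n))) → multiplicity S zero ≡ insideCount (heads S)
multiplicity-zero S = cong insideCount (map-cong (λ { (_ ∷ _) → refl }) S)

multiplicity-suc : (S : List (Subset (suc n))) (x : Fin n) →
                   multiplicity S (suc x) ≡ multiplicity (tails S) x
multiplicity-suc S x = cong insideCount (trans (map-cong (λ { (_ ∷ _) → refl }) S) (map-∘ S))

shared : List (Subset n) → Subset n
shared S = tabulate (λ x → 2 ≤ᵇ multiplicity S x)

shared-∷ : (S : List (Subset (suc n))) →
           shared S ≡ (2 ≤ᵇ insideCount (heads S)) ∷ shared (tails S)
shared-∷ S = cong₂ _∷_ (cong (2 ≤ᵇ_) (multiplicity-zero S))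
                       (tabulate-cong (cong (2 ≤ᵇ_) ∘ multiplicity-suc S))

∈-shared : ∀ {S : List (Subset n)} {A B x} → A ∈ˡ S → B ∈ˡ S → A ≢ B →
           x ∈ A → x ∈ B → x ∈ shared S
∈-shared {S = S} {x = x} A∈S B∈S A≢B x∈A x∈B =
  lookup⇒[]= x (shared S) (trans (lookup∘tabulate _ x) (Equivalence.to T-≡ (≤⇒≤ᵇ 2≤m)))
  where
  2≤m : 2 ≤ multiplicity S x
  2≤m = 2≤insideCount-map (λ A → lookup A x) A∈S B∈S A≢B ([]=⇒lookup x∈A) ([]=⇒lookup x∈B)

shared-double-count : (S : List (Subset n)) →
  sum (map (λ A → ∣ A ∩ shared S ∣) S) + 2 * ∣ ⋃ S ∣ ≤ 2 * sum (map ∣_∣ S)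
shared-double-count {zero} S =
  ≤-trans (≤-reflexive (cong₂ (λ a b → a + 2 * b) (vanish S) (n≤0⇒n≡0 (∣p∣≤n (⋃ S))))) z≤n
  where
  vanish : (S : List (Subset 0)) → sum (map (λ A → ∣ A ∩ [] ∣) S) ≡ 0
  vanish []       = refl
  vanish ([] ∷ S) = vanish S
shared-double-count {suc n} S = begin
  sum (map (λ A → ∣ A ∩ shared S ∣) S) + 2 * ∣ ⋃ S ∣
    ≡⟨ cong₂ (λ D k → sum (map (λ A → ∣ A ∩ D ∣) S) + 2 * k) (shared-∷ S) (∣⋃∣-∷ S) ⟩
  sum (map (λ A → ∣ A ∩ (s ∷ shared S′) ∣) S) + 2 * (o + ∣ ⋃ S′ ∣)
    ≡⟨ cong (_+ 2 * (o + ∣ ⋃ S′ ∣)) (sum-∣∩∣-∷ s (shared S′) S) ⟩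
  (w + X) + 2 * (o + ∣ ⋃ S′ ∣)
    ≡⟨ +-2*-interchange w X o ∣ ⋃ S′ ∣ ⟩
  (w + 2 * o) + (X + 2 * ∣ ⋃ S′ ∣)
    ≤⟨ +-mono-≤ (column-bound (heads S)) (shared-double-count S′) ⟩
  2 * c + 2 * sum (map ∣_∣ S′)
    ≡⟨ sym (*-distribˡ-+ 2 c _) ⟩
  2 * (c + sum (map ∣_∣ S′))
    ≡⟨ cong (2 *_) (sym (sum-∣∣-∷ S)) ⟩
  2 * sum (map ∣_∣ S) ∎
  where
  open ≤-Reasoning
  S′ = tails S
  c  = insideCount (heads S)
  s  = 2 ≤ᵇ c
  o  = if or (heads S) then 1 else 0
  w  = if s then c else 0
  X  = sum (map (λ A → ∣ A ∩ shared S′ ∣) S′)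

covering-bound : (S : List (Subset n)) → All (λ A → Nonempty (A ∩ shared S)) S →
                 length S + 2 * ∣ ⋃ S ∣ ≤ 2 * sum (map ∣_∣ S)
covering-bound S meets =
  ≤-trans (+-monoˡ-≤ _ (length≤sum-map (All.map (x∈p⇒0<∣p∣ ∘ proj₂) meets))) (shared-double-count S)

closedNbhd? : (w v : Subset n) → Dec (InClosedNbhd w v)
closedNbhd? w v = ≡-dec _≟_ v w ⊎-dec ¬? (nonempty? (w ∩ v))

meets-shared : ∀ {A} {S : List (Subset n)} →
               A ∈ˡ S → ¬ All (InClosedNbhd A) S → Nonempty (A ∩ shared S)
meets-shared {A = A} {S} A∈S ¬center =
  let v , v∈S , v∉N[A] = find (¬All⇒Any¬ (closedNbhd? A) S ¬center)
      x , x∈A∩v        = decidable-stable (nonempty? (A ∩ v)) (v∉N[A] ∘ inj₂)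
      x∈A , x∈v        = x∈p∩q⁻ A v x∈A∩v
  in x , x∈p∩q⁺ (x∈A , ∈-shared A∈S v∈S (v∉N[A] ∘ inj₁ ∘ sym) x∈A x∈v)

center-or-shared : (S : List (Subset n)) →
                   (∃ λ A → A ∈ˡ S × All (InClosedNbhd A) S)
                   ⊎ All (λ A → Nonempty (A ∩ shared S)) S
center-or-shared S with any? (λ A → All.all? (closedNbhd? A) S) S
... | yes center = inj₁ (find center)
... | no ¬center = inj₂ (All.tabulate λ A∈S → meets-shared A∈S (¬center ∘ lose A∈S))

vertex-avoiding : ∀ {r} (U : Subset n) → r + ∣ U ∣ ≤ n →
                  Σ (Subset n) λ w → IsVertex n r w × (∀ {A} → A ⊆ U → Adjacent w A)
vertex-avoiding {n} {r} U r+∣U∣≤n =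
  let r≤∣∁U∣            = subst (r ≤_) (sym (∣∁p∣≡n∸∣p∣ U)) (m+n≤o⇒m≤o∸n r r+∣U∣≤n)
      w , w⊆∁U , ∣w∣≡r = ⊆-of-size (∁ U) r≤∣∁U∣
      avoids : ∀ {A} → A ⊆ U → Adjacent w A
      avoids A⊆U (x , x∈w∩A) =
        let x∈w , x∈A = x∈p∩q⁻ w _ x∈w∩A in x∈∁p⇒x∉p (w⊆∁U x∈w) (A⊆U x∈A)
  in w , ∣w∣≡r , avoids

room-for-vertex : ∀ t r u n → t + 2 * u ≤ 2 * (t * r) → n ≥ (t + 1) * r ∸ ⌈ t /2⌉ → r + u ≤ n
room-for-vertex t r u n t+2u≤2tr n≥ = ≤-trans (m+n≤o⇒m≤o∸n (r + u) r+u+c≤) n≥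
  where
  open ≤-Reasoning
  c = ⌈ t /2⌉
  c+c≤1+t : c + c ≤ suc t
  c+c≤1+t = begin
    c + c              ≤⟨ +-monoʳ-≤ c (⌊n/2⌋≤⌈n/2⌉ (suc t)) ⟩
    c + ⌈ suc t /2⌉    ≡⟨ ⌊n/2⌋+⌈n/2⌉≡n (suc t) ⟩
    suc t              ∎
  u+c≤tr : u + c ≤ t * r
  u+c≤tr = 2*m≤1+2*n⇒m≤n (u + c) (t * r) (begin
    2 * (u + c)        ≡⟨ *-distribˡ-+ 2 u c ⟩
    2 * u + 2 * c      ≡⟨ cong (2 * u +_) (cong (c +_) (+-identityʳ c)) ⟩
    2 * u + (c + c)    ≤⟨ +-monoʳ-≤ (2 * u) c+c≤1+t ⟩
    2 * u + suc t      ≡⟨ trans (+-suc (2 * u) t) (cong suc (+-comm (2 * u) t)) ⟩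
    suc (t + 2 * u)    ≤⟨ s≤s t+2u≤2tr ⟩
    suc (2 * (t * r))  ∎)
  r+u+c≤ : r + u + c ≤ (t + 1) * r
  r+u+c≤ = begin
    r + u + c          ≡⟨ +-assoc r u c ⟩
    r + (u + c)        ≤⟨ +-monoʳ-≤ r u+c≤tr ⟩
    r + t * r          ≡⟨ cong (_* r) (+-comm 1 t) ⟩
    (t + 1) * r        ∎

lemma15 : (r t n : ℕ) → r ≥ 2 → t ≥ 2 → n ≥ (t + 1) * r ∸ ⌈ t /2⌉ →
    (S : List (Subset n)) → Unique S → length S ≡ t → All (IsVertex n r) S →
    Σ (Subset n) (λ w → IsVertex n r w × All (InClosedNbhd w) S)
lemma15 r t n _ _ n≥ S _ |S|≡t vertices with center-or-shared S
... | inj₁ (A , A∈S , S⊆N[A]) = A , All.lookup vertices A∈S , S⊆N[A]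
... | inj₂ meets =
  let w , ∣w∣≡r , avoids = vertex-avoiding (⋃ S) (room-for-vertex t r _ n t+2∣⋃S∣≤2tr n≥)
  in w , ∣w∣≡r , All.tabulate (inj₂ ∘ avoids ∘ ⊆⋃)
  where
  t+2∣⋃S∣≤2tr : t + 2 * ∣ ⋃ S ∣ ≤ 2 * (t * r)
  t+2∣⋃S∣≤2tr = subst₂ (λ l σ → l + 2 * ∣ ⋃ S ∣ ≤ 2 * σ)
    |S|≡t (trans (sum-map-constant vertices) (cong (_* r) |S|≡t)) (covering-bound S meets)
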